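{- Let $\mathbf A$ be a finite Boolean algebra and $P$ a conditional probability on $A\times A'$. For all $t,s,r\in\mathbb{T}(A)$: (1) $X_t=X_{t\wedge t}$; (2) $X_{t\wedge s}=X_{s\wedge t}$; (3) $X_{t\wedge(s\wedge r)}=X_{(t\wedge s)\wedge r}$; (4) $X_{t\wedge\neg t}=0$; (5) $X_{\neg(t\wedge s)}=X_{\neg t\vee\neg s}$; (6) $X_{t\wedge(s\vee r)}=X_{(t\wedge s)\vee(t\wedge r)}$; (7) $X_{t\vee s}=X_t+X_s-X_{t\wedge s}$; (8) $X_{\neg t}=1-X_t$, and hence $X_{\neg\neg t}=X_t$; (9) for all $a\in A$, $b\in A'$, $c\in A$ with $a\le b$: $X_{(a\mid b)\wedge(a\mid b\vee c)}=X_{(a\mid b\vee c)}$.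
   Context: $\mathbf A=(A,\wedge,\vee,\neg,\bot,\top)$ is a finite Boolean algebra; write $ab$ for $a\wedge b$, $\bar a$ for $\neg a$, and $A'=A\setminus\{\bot\}$. $\Omega$ is the set of Boolean homomorphisms $w:\mathbf A\to\{0,1\}$ (identified with atoms); $w\models a$ means $w(a)=1$. A basic conditional is a pair $(a\mid b)$, $a\in A$, $b\in A'$. $\mathbb{T}(A)$ is the set of terms built from basic conditionals (as variables) and constants $0,1$ using $\neg,\wedge,\vee$. $\mathbf b(t)$ is the disjunction of the antecedents of the basic conditionals occurring in $t$ ($\top$ if $t\in\{0,1\}$). The $w$-reduct $t^w$ is obtained by replacing each occurring $(a_i\mid b_i)$ by $1$ if $w\models a_ib_i$, by $0$ if $w\models\bar a_ib_i$ (unchanged if $w\models\bar b_i$), then applying $\neg1:=0$, $\neg0:=1$, $r\wedge1=1\wedge r:=r$, $r\wedge0=0\wedge r:=0$, $r\vee1=1\vee r:=1$, $r\vee0=0\vee r:=r$ to subterms until no rule applies. A conditional probability on $A\times A'$ is $P:A\times A'\to[0,1]$ with $P(\cdot\mid b)$ a finitely additive probability for each $b\in A'$, $P(b\mid b)=1$, $P(ab\mid c)=P(a\mid bc)P(b\mid c)$. $\mathbb P(X\mid b)=\sum_wX(w)P(w\mid b)$. Given $P$, $X_t:\Omega\to[0,1]$ is defined recursively by $X_1\equiv1$, $X_0\equiv0$, $X_t(w)=\mathbb P(X_{t^w}\mid\mathbf b(t^w))$; for $w\models\neg\mathbf b(t)$, $t^w=t$ and $X_t(w)=\mathbb P(X_t\mid\mathbf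 b(t))$, which depends only on $X_t$ at worlds satisfying $\mathbf b(t)$. The constant function with value $0$ is written $0$. -}

module Defs where

open import Level using (Level; _⊔_) renaming (suc to lsuc)
open import Data.Nat using (ℕ; zero; suc) renaming (_+_ to _+ℕ_)
open import Data.Bool using (Bool; true; false; if_then_else_; _∧_)
open import Data.Fin using (Fin)
import Data.Fin as Fin
open import Data.Vec using (lookup)
open import Data.Fin.Subset
  using (Subset; Nonempty; ⁅_⁆; _∩_; _∪_; ∁; _⊆_)
  renaming (⊥ to ∅; ⊤ to full)
open import Algebra.Bundles using (CommutativeRing)
open import Relation.Binary.Structures using (IsTotalOrder)
open import Relation.Binary.PropositionalEquality using (_≡_)

-- Scalars: an ordered commutative ring (the real numbers are an instance).

record OrderedCommRing (c ℓ₁ ℓ₂ : Level) : Set (lsuc (c ⊔ ℓ₁ ⊔ ℓ₂)) where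
  field
    commutativeRing : CommutativeRing c ℓ₁
  open CommutativeRing commutativeRing public
  field
    _≤_         : Carrier → Carrier → Set ℓ₂
    isTotalOrder : IsTotalOrder _≈_ _≤_
    +-monoʳ-≤   : ∀ z {x y} → x ≤ y → (z + x) ≤ (z + y)
    0≤*         : ∀ {x y} → 0# ≤ x → 0# ≤ y → 0# ≤ (x * y)

-- The finite Boolean algebra is represented (Stone) as the powerset
-- Subset n of its n atoms; the atoms Fin n are the worlds w ∈ Ω, and
-- w ⊨ a iff the atom w lies below a.

_⊨_ : ∀ {n} → Fin n → Subset n → Bool
w ⊨ a = lookup a w

-- Terms of 𝕋(A): basic conditionals (a ∣ b) with b ∈ A' = A ∖ {⊥}.
data Term (n : ℕ) : Set where
  cnd  : (a b : Subset n) → Nonempty b → Term n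
  𝟎 𝟏  : Term n
  ¬ₜ_  : Term n → Term n
  _∧ₜ_ : Term n → Term n → Term n
  _∨ₜ_ : Term n → Term n → Term n

infix  8 ¬ₜ_
infixr 7 _∧ₜ_
infixr 6 _∨ₜ_

module _ {n : ℕ} where

  ants : Term n → Subset n
  ants (cnd a b _) = b
  ants 𝟎 = ∅
  ants 𝟏 = ∅
  ants (¬ₜ t) = ants t
  ants (t ∧ₜ s) = ants t ∪ ants s
  ants (t ∨ₜ s) = ants t ∪ ants s

  𝐛 : Term n → Subset n
  𝐛 𝟎 = full
  𝐛 𝟏 = full
  𝐛 t = ants t

  occ : Term n → ℕ
  occ (cnd _ _ _) = 1
  occ 𝟎 = 0
  occ 𝟏 = 0
  occ (¬ₜ t) = occ t
  occ (t ∧ₜ s) = occ t +ℕ occ s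
  occ (t ∨ₜ s) = occ t +ℕ occ s

  subst : Fin n → Term n → Term n
  subst w (cnd a b p) =
    if w ⊨ (a ∩ b) then 𝟏 else (if w ⊨ b then 𝟎 else cnd a b p)
  subst w 𝟎 = 𝟎
  subst w 𝟏 = 𝟏
  subst w (¬ₜ t) = ¬ₜ subst w t
  subst w (t ∧ₜ s) = subst w t ∧ₜ subst w s
  subst w (t ∨ₜ s) = subst w t ∨ₜ subst w s

  neg : Term n → Term n
  neg 𝟏 = 𝟎
  neg 𝟎 = 𝟏
  neg t = ¬ₜ t

  conj : Term n → Term n → Term n
  conj r 𝟏 = r
  conj 𝟏 r = r
  conj r 𝟎 = 𝟎
  conj 𝟎 r = 𝟎
  conj r s = r ∧ₜ s

  disj : Term n → Term n → Term n
  disj r 𝟏 = 𝟏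
  disj 𝟏 r = 𝟏
  disj r 𝟎 = r
  disj 𝟎 r = r
  disj r s = r ∨ₜ s

  simp : Term n → Term n
  simp (cnd a b p) = cnd a b p
  simp 𝟎 = 𝟎
  simp 𝟏 = 𝟏
  simp (¬ₜ t) = neg (simp t)
  simp (t ∧ₜ s) = conj (simp t) (simp s)
  simp (t ∨ₜ s) = disj (simp t) (simp s)

  reduct : Fin n → Term n → Term n
  reduct w t = simp (subst w t)

sumFin : ∀ {c ℓ₁ ℓ₂} (R : OrderedCommRing c ℓ₁ ℓ₂) (n : ℕ) →
         (Fin n → OrderedCommRing.Carrier R) → OrderedCommRing.Carrier R
sumFin R zero    f = OrderedCommRing.0# R
sumFin R (suc n) f = OrderedCommRing._+_ R (f Fin.zero) (sumFin R n (λ i → f (Fin.suc i)))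

module _ {c ℓ₁ ℓ₂} (R : OrderedCommRing c ℓ₁ ℓ₂) (n : ℕ) where
  open OrderedCommRing R

  -- Conditional probability on A × A'.  P is given as a total function
  -- Subset n → Subset n → Carrier, but all axioms (and all uses) only
  -- concern nonempty conditioning events b ∈ A'.
  record IsCondProb (P : Subset n → Subset n → Carrier) : Set (c ⊔ ℓ₁ ⊔ ℓ₂) where
    field
      nonneg   : ∀ a b → Nonempty b → 0# ≤ P a b
      total    : ∀ b → Nonempty b → P full b ≈ 1#
      additive : ∀ a a' b → Nonempty b → a ∩ a' ≡ ∅ →
                 P (a ∪ a') b ≈ P a b + P a' b
      self     : ∀ b → Nonempty b → P b b ≈ 1#
      chain    : ∀ a b c → Nonempty (b ∩ c) →
                 P (a ∩ b) c ≈ P a (b ∩ c) * P b c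

  module _ (P : Subset n → Subset n → Carrier) where

    -- E k u = ℙ(X_u ∣ 𝐛(u)) computed with fuel k (k > occ u suffices).
    -- For u ∉ {0,1}, ℙ(X_u ∣ 𝐛(u)) = Σ_{w' ⊨ 𝐛(u)} X_u(w') P(w' ∣ 𝐛(u)),
    -- and X_u(w') = ℙ(X_{u^{w'}} ∣ 𝐛(u^{w'})) with occ (u^{w'}) < occ u.
    E : ℕ → Term n → Carrier
    E zero    u = 0#
    E (suc k) 𝟎 = 0#
    E (suc k) 𝟏 = 1#
    E (suc k) u = sumFin R n (λ w' →
      if w' ⊨ 𝐛 u then E k (reduct w' u) * P ⁅ w' ⁆ (𝐛 u) else 0#)

    X : Term n → Fin n → Carrier
    X t w = E (suc (occ t)) (reduct w t)

    _≐_ : (Fin n → Carrier) → (Fin n → Carrier) → Set ℓ₁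
    f ≐ g = ∀ w → f w ≈ g w

module Submission where

-- Call a term simplified if it is 𝟎, 𝟏 or contains no constants; every reduct t^w is.
-- For simplified u let value u = ℙ(X_u ∣ 𝐛(u)), so that X_t(w) = value (t^w).  Since
-- u^w = u when w ⊭ 𝐛(u), the tower property of conditional probability gives
-- value u = ℙ(w ↦ value (u^w) ∣ C) for every nonempty C ⊇ 𝐛(u).  Comparing two terms over
-- the union of their antecedents, by induction on the number of occurrences of basic
-- conditionals (which drops in u^w whenever w ⊨ 𝐛(u)), value u depends only on the Boolean
-- function that u denotes when its basic conditionals are read as independent propositional
-- variables.  This gives (1)-(6) and X_¬¬t = X_t at once.  The same induction together with
-- linearity of ℙ(· ∣ C) gives (7), and (8) is (7) for t ∨ ¬t ≋ 1, as t ∧ ¬t ≋ 0.  For (9),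
-- a ≤ b makes both terms have the same reduct at every world of b ∨ c.

open import Defs
import Algebra.Properties.Group as GroupProperties
import Algebra.Properties.Ring as RingProperties
import Algebra.Properties.Semiring.Sum as SemiringSum
open import Data.Bool using (Bool; true; false; if_then_else_; not; _∧_; _∨_)
open import Data.Bool.Properties
  using ( ∧-idem; ∧-comm; ∧-assoc; ∧-zeroʳ; ∧-identityʳ; ∧-inverseʳ; ∧-distribˡ-∨
        ; ∨-zeroʳ; ∨-identityʳ; ∨-inverseʳ; not-involutive; ∨-∧-booleanAlgebra )
open import Algebra.Lattice.Properties.BooleanAlgebra ∨-∧-booleanAlgebra using (deMorgan₁)
open import Data.Fin using (Fin; zero; suc)
open import Data.Fin.Properties using (suc-injective)
open import Data.Fin.Subset
  using (Subset; Nonempty; Empty; _∈_; _∉_; _⊆_; _∪_; _∩_; ⁅_⁆) renaming (⊥ to ∅)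
open import Data.Fin.Subset.Properties
  using ( _∈?_; ∉⊥; ⊆-refl; ⊆-min; ⊆-antisym; p⊆p∪q; q⊆p∪q; p∩q⊆p
        ; x∈p∪q⁺; x∈p∪q⁻; x∈p∩q⁺; x∈p∩q⁻; x∈⁅x⁆; x∈⁅y⁆⇒x≡y
        ; Empty-unique; ∪-identityʳ; ∩-zeroʳ )
open import Data.Nat using (ℕ; zero; suc; _≤_; _<_; z≤n; s≤s) renaming (_+_ to _+ℕ_)
open import Data.Nat.Properties
  using ( ≤-refl; ≤-trans; ≤-<-trans; <-≤-trans
        ; +-mono-≤; +-mono-<-≤; +-mono-≤-<; m≤m+n; n<1+n )
open import Data.Product using (∃; _×_; _,_; proj₁; proj₂)
open import Data.Sum using (inj₁; inj₂)
open import Data.Vec.Functional using (foldr)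
open import Data.Vec.Properties using (lookup-zipWith; lookup⇒[]=; []=⇒lookup)
open import Function using (_∘_)
open import Relation.Binary.PropositionalEquality
  using (_≡_; refl; sym; trans; cong; cong₂; module ≡-Reasoning)
open import Relation.Nullary using (contradiction; yes; no)
import Relation.Binary.Reasoning.Setoid as SetoidReasoning

module _ {n : ℕ} where

  ∈⇒⊨ : ∀ {w : Fin n} {p} → w ∈ p → w ⊨ p ≡ true
  ∈⇒⊨ = []=⇒lookup

  ⊨⇒∈ : ∀ {w : Fin n} {p} → w ⊨ p ≡ true → w ∈ p
  ⊨⇒∈ {w} {p} = lookup⇒[]= w p

  ⊭⇒∉ : ∀ {w : Fin n} {p} → w ⊨ p ≡ false → w ∉ p
  ⊭⇒∉ w⊭p w∈p with () ← trans (sym (∈⇒⊨ w∈p)) w⊭p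

  ⊨-∩ : ∀ (w : Fin n) p q → w ⊨ (p ∩ q) ≡ (w ⊨ p ∧ w ⊨ q)
  ⊨-∩ w p q = lookup-zipWith _∧_ w p q

  ⊨-∪ : ∀ (w : Fin n) p q → w ⊨ (p ∪ q) ≡ (w ⊨ p ∨ w ⊨ q)
  ⊨-∪ w p q = lookup-zipWith _∨_ w p q

  p⊆q⇒p∩q≡p : ∀ {p q : Subset n} → p ⊆ q → p ∩ q ≡ p
  p⊆q⇒p∩q≡p {p} {q} p⊆q =
    ⊆-antisym (p∩q⊆p p q) (λ x∈p → x∈p∩q⁺ (x∈p , p⊆q x∈p))

  ⋃ᶠ : ∀ {m} → (Fin m → Subset n) → Subset n
  ⋃ᶠ = foldr _∪_ ∅

  x∈⋃ᶠ⁺ : ∀ {m} {h : Fin m → Subset n} {x} i → x ∈ h i → x ∈ ⋃ᶠ h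
  x∈⋃ᶠ⁺ zero    x∈ = x∈p∪q⁺ (inj₁ x∈)
  x∈⋃ᶠ⁺ (suc i) x∈ = x∈p∪q⁺ (inj₂ (x∈⋃ᶠ⁺ i x∈))

  x∈⋃ᶠ⁻ : ∀ m {h : Fin m → Subset n} {x} → x ∈ ⋃ᶠ h → ∃ λ i → x ∈ h i
  x∈⋃ᶠ⁻ zero    x∈ = contradiction x∈ ∉⊥
  x∈⋃ᶠ⁻ (suc m) {h} x∈ with x∈p∪q⁻ (h zero) (⋃ᶠ (h ∘ suc)) x∈
  ... | inj₁ x∈h₀ = zero , x∈h₀
  ... | inj₂ x∈⋃  with i , x∈hᵢ ← x∈⋃ᶠ⁻ m x∈⋃ = suc i , x∈hᵢ

  Disjointᶠ : ∀ {m} → (Fin m → Subset n) → Set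
  Disjointᶠ h = ∀ {i j x} → x ∈ h i → x ∈ h j → i ≡ j

  atom : Subset n → Fin n → Subset n
  atom c w = if w ⊨ c then ⁅ w ⁆ else ∅

  x∈atom⁻ : ∀ (c : Subset n) w {x} → x ∈ atom c w → x ≡ w × w ∈ c
  x∈atom⁻ c w x∈ with w ⊨ c in e
  ... | true  = x∈⁅y⁆⇒x≡y w x∈ , ⊨⇒∈ e
  ... | false = contradiction x∈ ∉⊥

  atom-disjoint : ∀ (c : Subset n) → Disjointᶠ (atom c)
  atom-disjoint c {i} {j} x∈aᵢ x∈aⱼ
    with refl , _ ← x∈atom⁻ c i x∈aᵢ
    with refl , _ ← x∈atom⁻ c j x∈aⱼ = refl

  ⋃ᶠ-atom : ∀ (c : Subset n) → ⋃ᶠ (atom c) ≡ c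
  ⋃ᶠ-atom c = ⊆-antisym ⋃⊆c c⊆⋃
    where
    ⋃⊆c : ⋃ᶠ (atom c) ⊆ c
    ⋃⊆c x∈
      with i , x∈aᵢ ← x∈⋃ᶠ⁻ n x∈
      with refl , i∈c ← x∈atom⁻ c i x∈aᵢ = i∈c
    c⊆⋃ : c ⊆ ⋃ᶠ (atom c)
    c⊆⋃ {x} x∈c = x∈⋃ᶠ⁺ x x∈atom
      where
      x∈atom : x ∈ atom c x
      x∈atom with x ⊨ c in e
      ... | true  = x∈⁅x⁆ x
      ... | false = contradiction x∈c (⊭⇒∉ e)

module _ {n : ℕ} where

  data ConstantFree : Term n → Set where
    cnd  : ∀ {a b} {p : Nonempty b} → ConstantFree (cnd a b p)
    ¬ₜ_  : ∀ {t} → ConstantFree t → ConstantFree (¬ₜ t)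
    _∧ₜ_ : ∀ {t s} → ConstantFree t → ConstantFree s → ConstantFree (t ∧ₜ s)
    _∨ₜ_ : ∀ {t s} → ConstantFree t → ConstantFree s → ConstantFree (t ∨ₜ s)

  data Simplified : Term n → Set where
    𝟎 : Simplified 𝟎
    𝟏 : Simplified 𝟏
    constantFree : ∀ {t} → ConstantFree t → Simplified t

  neg-constantFree : ∀ {t} → ConstantFree t → neg t ≡ ¬ₜ t
  neg-constantFree cnd      = refl
  neg-constantFree (¬ₜ _)   = refl
  neg-constantFree (_ ∧ₜ _) = refl
  neg-constantFree (_ ∨ₜ _) = refl

  conj-constantFree : ∀ {r s} → ConstantFree r → ConstantFree s → conj r s ≡ r ∧ₜ s
  conj-constantFree cnd      cnd      = refl
  conj-constantFree cnd      (¬ₜ _)   = refl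
  conj-constantFree cnd      (_ ∧ₜ _) = refl
  conj-constantFree cnd      (_ ∨ₜ _) = refl
  conj-constantFree (¬ₜ _)   cnd      = refl
  conj-constantFree (¬ₜ _)   (¬ₜ _)   = refl
  conj-constantFree (¬ₜ _)   (_ ∧ₜ _) = refl
  conj-constantFree (¬ₜ _)   (_ ∨ₜ _) = refl
  conj-constantFree (_ ∧ₜ _) cnd      = refl
  conj-constantFree (_ ∧ₜ _) (¬ₜ _)   = refl
  conj-constantFree (_ ∧ₜ _) (_ ∧ₜ _) = refl
  conj-constantFree (_ ∧ₜ _) (_ ∨ₜ _) = refl
  conj-constantFree (_ ∨ₜ _) cnd      = refl
  conj-constantFree (_ ∨ₜ _) (¬ₜ _)   = refl
  conj-constantFree (_ ∨ₜ _) (_ ∧ₜ _) = refl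
  conj-constantFree (_ ∨ₜ _) (_ ∨ₜ _) = refl

  disj-constantFree : ∀ {r s} → ConstantFree r → ConstantFree s → disj r s ≡ r ∨ₜ s
  disj-constantFree cnd      cnd      = refl
  disj-constantFree cnd      (¬ₜ _)   = refl
  disj-constantFree cnd      (_ ∧ₜ _) = refl
  disj-constantFree cnd      (_ ∨ₜ _) = refl
  disj-constantFree (¬ₜ _)   cnd      = refl
  disj-constantFree (¬ₜ _)   (¬ₜ _)   = refl
  disj-constantFree (¬ₜ _)   (_ ∧ₜ _) = refl
  disj-constantFree (¬ₜ _)   (_ ∨ₜ _) = refl
  disj-constantFree (_ ∧ₜ _) cnd      = refl
  disj-constantFree (_ ∧ₜ _) (¬ₜ _)   = refl
  disj-constantFree (_ ∧ₜ _) (_ ∧ₜ _) = refl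
  disj-constantFree (_ ∧ₜ _) (_ ∨ₜ _) = refl
  disj-constantFree (_ ∨ₜ _) cnd      = refl
  disj-constantFree (_ ∨ₜ _) (¬ₜ _)   = refl
  disj-constantFree (_ ∨ₜ _) (_ ∧ₜ _) = refl
  disj-constantFree (_ ∨ₜ _) (_ ∨ₜ _) = refl

  conj-zeroˡ : ∀ (t : Term n) → conj 𝟎 t ≡ 𝟎
  conj-zeroˡ (cnd _ _ _) = refl
  conj-zeroˡ 𝟎           = refl
  conj-zeroˡ 𝟏           = refl
  conj-zeroˡ (¬ₜ _)      = refl
  conj-zeroˡ (_ ∧ₜ _)    = refl
  conj-zeroˡ (_ ∨ₜ _)    = refl

  conj-zeroʳ : ∀ (t : Term n) → conj t 𝟎 ≡ 𝟎
  conj-zeroʳ (cnd _ _ _) = refl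
  conj-zeroʳ 𝟎           = refl
  conj-zeroʳ 𝟏           = refl
  conj-zeroʳ (¬ₜ _)      = refl
  conj-zeroʳ (_ ∧ₜ _)    = refl
  conj-zeroʳ (_ ∨ₜ _)    = refl

  conj-identityˡ : ∀ (t : Term n) → conj 𝟏 t ≡ t
  conj-identityˡ (cnd _ _ _) = refl
  conj-identityˡ 𝟎           = refl
  conj-identityˡ 𝟏           = refl
  conj-identityˡ (¬ₜ _)      = refl
  conj-identityˡ (_ ∧ₜ _)    = refl
  conj-identityˡ (_ ∨ₜ _)    = refl

  disj-zeroˡ : ∀ (t : Term n) → disj 𝟏 t ≡ 𝟏
  disj-zeroˡ (cnd _ _ _) = refl
  disj-zeroˡ 𝟎           = refl
  disj-zeroˡ 𝟏           = refl
  disj-zeroˡ (¬ₜ _)      = refl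
  disj-zeroˡ (_ ∧ₜ _)    = refl
  disj-zeroˡ (_ ∨ₜ _)    = refl

  disj-identityˡ : ∀ (t : Term n) → disj 𝟎 t ≡ t
  disj-identityˡ (cnd _ _ _) = refl
  disj-identityˡ 𝟎           = refl
  disj-identityˡ 𝟏           = refl
  disj-identityˡ (¬ₜ _)      = refl
  disj-identityˡ (_ ∧ₜ _)    = refl
  disj-identityˡ (_ ∨ₜ _)    = refl

  disj-identityʳ : ∀ (t : Term n) → disj t 𝟎 ≡ t
  disj-identityʳ (cnd _ _ _) = refl
  disj-identityʳ 𝟎           = refl
  disj-identityʳ 𝟏           = refl
  disj-identityʳ (¬ₜ _)      = refl
  disj-identityʳ (_ ∧ₜ _)    = refl
  disj-identityʳ (_ ∨ₜ _)    = refl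

  simplified-neg : ∀ {t} → Simplified t → Simplified (neg t)
  simplified-neg 𝟎 = 𝟏
  simplified-neg 𝟏 = 𝟎
  simplified-neg (constantFree x) rewrite neg-constantFree x = constantFree (¬ₜ x)

  simplified-conj : ∀ {r s} → Simplified r → Simplified s → Simplified (conj r s)
  simplified-conj {s = s} 𝟎 _ rewrite conj-zeroˡ s = 𝟎
  simplified-conj {s = s} 𝟏 y rewrite conj-identityˡ s = y
  simplified-conj {r = r} (constantFree _) 𝟎 rewrite conj-zeroʳ r = 𝟎
  simplified-conj (constantFree x) 𝟏 = constantFree x
  simplified-conj (constantFree x) (constantFree y)
    rewrite conj-constantFree x y = constantFree (x ∧ₜ y)

  simplified-disj : ∀ {r s} → Simplified r → Simplified s → Simplified (disj r s)
  simplified-disj {s = s} 𝟎 y rewrite disj-identityˡ s = y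
  simplified-disj {s = s} 𝟏 _ rewrite disj-zeroˡ s = 𝟏
  simplified-disj {r = r} (constantFree x) 𝟎 rewrite disj-identityʳ r = constantFree x
  simplified-disj (constantFree x) 𝟏 = 𝟏
  simplified-disj (constantFree x) (constantFree y)
    rewrite disj-constantFree x y = constantFree (x ∨ₜ y)

  simp-simplified : ∀ (t : Term n) → Simplified (simp t)
  simp-simplified (cnd _ _ _) = constantFree cnd
  simp-simplified 𝟎 = 𝟎
  simp-simplified 𝟏 = 𝟏
  simp-simplified (¬ₜ t)   = simplified-neg (simp-simplified t)
  simp-simplified (t ∧ₜ s) = simplified-conj (simp-simplified t) (simp-simplified s)
  simp-simplified (t ∨ₜ s) = simplified-disj (simp-simplified t) (simp-simplified s)

  simp-constantFree : ∀ {t} → ConstantFree t → simp t ≡ t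
  simp-constantFree cnd = refl
  simp-constantFree (¬ₜ x) rewrite simp-constantFree x = neg-constantFree x
  simp-constantFree (x ∧ₜ y)
    rewrite simp-constantFree x | simp-constantFree y = conj-constantFree x y
  simp-constantFree (x ∨ₜ y)
    rewrite simp-constantFree x | simp-constantFree y = disj-constantFree x y

  Valuation : Set
  Valuation = Subset n → Subset n → Bool

  ⟦_⟧ : Term n → Valuation → Bool
  ⟦ cnd a b _ ⟧ ν = ν a b
  ⟦ 𝟎 ⟧     _ = false
  ⟦ 𝟏 ⟧     _ = true
  ⟦ ¬ₜ t ⟧   ν = not (⟦ t ⟧ ν)
  ⟦ t ∧ₜ s ⟧ ν = ⟦ t ⟧ ν ∧ ⟦ s ⟧ ν
  ⟦ t ∨ₜ s ⟧ ν = ⟦ t ⟧ ν ∨ ⟦ s ⟧ ν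

  infix 4 _≋_
  _≋_ : Term n → Term n → Set
  t ≋ s = ∀ ν → ⟦ t ⟧ ν ≡ ⟦ s ⟧ ν

  ⟦neg⟧ : ∀ {t} → Simplified t → ∀ ν → ⟦ neg t ⟧ ν ≡ not (⟦ t ⟧ ν)
  ⟦neg⟧ 𝟎 ν = refl
  ⟦neg⟧ 𝟏 ν = refl
  ⟦neg⟧ (constantFree x) ν rewrite neg-constantFree x = refl

  ⟦conj⟧ : ∀ {r s} → Simplified r → Simplified s →
           ∀ ν → ⟦ conj r s ⟧ ν ≡ ⟦ r ⟧ ν ∧ ⟦ s ⟧ ν
  ⟦conj⟧ {s = s} 𝟎 _ ν rewrite conj-zeroˡ s = refl
  ⟦conj⟧ {s = s} 𝟏 _ ν rewrite conj-identityˡ s = refl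
  ⟦conj⟧ {r = r} (constantFree _) 𝟎 ν rewrite conj-zeroʳ r = sym (∧-zeroʳ _)
  ⟦conj⟧ (constantFree _) 𝟏 ν = sym (∧-identityʳ _)
  ⟦conj⟧ (constantFree x) (constantFree y) ν rewrite conj-constantFree x y = refl

  ⟦disj⟧ : ∀ {r s} → Simplified r → Simplified s →
           ∀ ν → ⟦ disj r s ⟧ ν ≡ ⟦ r ⟧ ν ∨ ⟦ s ⟧ ν
  ⟦disj⟧ {s = s} 𝟎 _ ν rewrite disj-identityˡ s = refl
  ⟦disj⟧ {s = s} 𝟏 _ ν rewrite disj-zeroˡ s = refl
  ⟦disj⟧ {r = r} (constantFree _) 𝟎 ν rewrite disj-identityʳ r = sym (∨-identityʳ _)
  ⟦disj⟧ (constantFree _) 𝟏 ν = sym (∨-zeroʳ _)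
  ⟦disj⟧ (constantFree x) (constantFree y) ν rewrite disj-constantFree x y = refl

  ⟦simp⟧ : ∀ (t : Term n) ν → ⟦ simp t ⟧ ν ≡ ⟦ t ⟧ ν
  ⟦simp⟧ (cnd _ _ _) ν = refl
  ⟦simp⟧ 𝟎 ν = refl
  ⟦simp⟧ 𝟏 ν = refl
  ⟦simp⟧ (¬ₜ t) ν = trans (⟦neg⟧ (simp-simplified t) ν) (cong not (⟦simp⟧ t ν))
  ⟦simp⟧ (t ∧ₜ s) ν =
    trans (⟦conj⟧ (simp-simplified t) (simp-simplified s) ν)
          (cong₂ _∧_ (⟦simp⟧ t ν) (⟦simp⟧ s ν))
  ⟦simp⟧ (t ∨ₜ s) ν =
    trans (⟦disj⟧ (simp-simplified t) (simp-simplified s) ν)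
          (cong₂ _∨_ (⟦simp⟧ t ν) (⟦simp⟧ s ν))

  occ-neg : ∀ {t} → Simplified t → occ (neg t) ≤ occ t
  occ-neg 𝟎 = z≤n
  occ-neg 𝟏 = z≤n
  occ-neg (constantFree x) rewrite neg-constantFree x = ≤-refl

  occ-conj : ∀ {r s} → Simplified r → Simplified s → occ (conj r s) ≤ occ r +ℕ occ s
  occ-conj {s = s} 𝟎 _ rewrite conj-zeroˡ s = z≤n
  occ-conj {s = s} 𝟏 _ rewrite conj-identityˡ s = ≤-refl
  occ-conj {r = r} (constantFree _) 𝟎 rewrite conj-zeroʳ r = z≤n
  occ-conj {r = r} (constantFree _) 𝟏 = m≤m+n (occ r) 0
  occ-conj (constantFree x) (constantFree y) rewrite conj-constantFree x y = ≤-refl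

  occ-disj : ∀ {r s} → Simplified r → Simplified s → occ (disj r s) ≤ occ r +ℕ occ s
  occ-disj {s = s} 𝟎 _ rewrite disj-identityˡ s = ≤-refl
  occ-disj {s = s} 𝟏 _ rewrite disj-zeroˡ s = z≤n
  occ-disj {r = r} (constantFree _) 𝟎 rewrite disj-identityʳ r = m≤m+n (occ r) 0
  occ-disj (constantFree _) 𝟏 = z≤n
  occ-disj (constantFree x) (constantFree y) rewrite disj-constantFree x y = ≤-refl

  occ-simp : ∀ (t : Term n) → occ (simp t) ≤ occ t
  occ-simp (cnd _ _ _) = ≤-refl
  occ-simp 𝟎 = z≤n
  occ-simp 𝟏 = z≤n
  occ-simp (¬ₜ t) = ≤-trans (occ-neg (simp-simplified t)) (occ-simp t)
  occ-simp (t ∧ₜ s) =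
    ≤-trans (occ-conj (simp-simplified t) (simp-simplified s)) (+-mono-≤ (occ-simp t) (occ-simp s))
  occ-simp (t ∨ₜ s) =
    ≤-trans (occ-disj (simp-simplified t) (simp-simplified s)) (+-mono-≤ (occ-simp t) (occ-simp s))

  occ-subst : ∀ w (t : Term n) → occ (subst w t) ≤ occ t
  occ-subst w (cnd a b _) with w ⊨ (a ∩ b) | w ⊨ b
  ... | true  | _     = z≤n
  ... | false | true  = z≤n
  ... | false | false = ≤-refl
  occ-subst w 𝟎 = z≤n
  occ-subst w 𝟏 = z≤n
  occ-subst w (¬ₜ t)   = occ-subst w t
  occ-subst w (t ∧ₜ s) = +-mono-≤ (occ-subst w t) (occ-subst w s)
  occ-subst w (t ∨ₜ s) = +-mono-≤ (occ-subst w t) (occ-subst w s)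

  occ-subst-< : ∀ {w} (t : Term n) → w ∈ ants t → occ (subst w t) < occ t
  occ-subst-< {w} (cnd a b _) w∈b with w ⊨ (a ∩ b) | w ⊨ b in e
  ... | true  | _     = s≤s z≤n
  ... | false | true  = s≤s z≤n
  ... | false | false = contradiction w∈b (⊭⇒∉ e)
  occ-subst-< 𝟎 w∈∅ = contradiction w∈∅ ∉⊥
  occ-subst-< 𝟏 w∈∅ = contradiction w∈∅ ∉⊥
  occ-subst-< (¬ₜ t) w∈ = occ-subst-< t w∈
  occ-subst-< {w} (t ∧ₜ s) w∈ with x∈p∪q⁻ (ants t) (ants s) w∈
  ... | inj₁ w∈t = +-mono-<-≤ (occ-subst-< t w∈t) (occ-subst w s)
  ... | inj₂ w∈s = +-mono-≤-< (occ-subst w t) (occ-subst-< s w∈s)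
  occ-subst-< {w} (t ∨ₜ s) w∈ with x∈p∪q⁻ (ants t) (ants s) w∈
  ... | inj₁ w∈t = +-mono-<-≤ (occ-subst-< t w∈t) (occ-subst w s)
  ... | inj₂ w∈s = +-mono-≤-< (occ-subst w t) (occ-subst-< s w∈s)

  occ-reduct : ∀ w (t : Term n) → occ (reduct w t) ≤ occ t
  occ-reduct w t = ≤-trans (occ-simp (subst w t)) (occ-subst w t)

  occ-reduct-< : ∀ {w} (t : Term n) → w ∈ ants t → occ (reduct w t) < occ t
  occ-reduct-< {w} t w∈t = ≤-<-trans (occ-simp (subst w t)) (occ-subst-< t w∈t)

  occ-reduct₂-< : ∀ {w} (t s : Term n) → w ∈ ants t ∪ ants s →
                  occ (reduct w t) +ℕ occ (reduct w s) < occ t +ℕ occ s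
  occ-reduct₂-< {w} t s w∈ =
    ≤-<-trans (+-mono-≤ (occ-simp (subst w t)) (occ-simp (subst w s))) (occ-subst-< (t ∧ₜ s) w∈)

  ants-conj : ∀ {r s} → Simplified r → Simplified s → ants (conj r s) ⊆ ants r ∪ ants s
  ants-conj {s = s} 𝟎 _ rewrite conj-zeroˡ s = ⊆-min _
  ants-conj {s = s} 𝟏 _ rewrite conj-identityˡ s = q⊆p∪q ∅ (ants s)
  ants-conj {r = r} (constantFree _) 𝟎 rewrite conj-zeroʳ r = ⊆-min _
  ants-conj (constantFree _) 𝟏 = p⊆p∪q ∅
  ants-conj (constantFree x) (constantFree y) rewrite conj-constantFree x y = ⊆-refl

  ants-disj : ∀ {r s} → Simplified r → Simplified s → ants (disj r s) ⊆ ants r ∪ ants s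
  ants-disj {s = s} 𝟎 _ rewrite disj-identityˡ s = q⊆p∪q ∅ (ants s)
  ants-disj {s = s} 𝟏 _ rewrite disj-zeroˡ s = ⊆-min _
  ants-disj {r = r} (constantFree _) 𝟎 rewrite disj-identityʳ r = p⊆p∪q ∅
  ants-disj (constantFree _) 𝟏 = ⊆-min _
  ants-disj (constantFree x) (constantFree y) rewrite disj-constantFree x y = ⊆-refl

  nonempty-ants : ∀ {t} → ConstantFree t → Nonempty (ants t)
  nonempty-ants (cnd {p = p}) = p
  nonempty-ants (¬ₜ x) = nonempty-ants x
  nonempty-ants (x ∧ₜ _) with w , w∈ ← nonempty-ants x = w , x∈p∪q⁺ (inj₁ w∈)
  nonempty-ants (x ∨ₜ _) with w , w∈ ← nonempty-ants x = w , x∈p∪q⁺ (inj₁ w∈)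

  subst-fixed : ∀ {w t} → ConstantFree t → w ∉ ants t → subst w t ≡ t
  subst-fixed {w} (cnd {a} {b}) w∉b with w ⊨ (a ∩ b) in e₁ | w ⊨ b in e₂
  ... | true  | _     = contradiction (proj₂ (x∈p∩q⁻ a b (⊨⇒∈ e₁))) w∉b
  ... | false | true  = contradiction (⊨⇒∈ e₂) w∉b
  ... | false | false = refl
  subst-fixed (¬ₜ x) w∉ = cong ¬ₜ_ (subst-fixed x w∉)
  subst-fixed (x ∧ₜ y) w∉ =
    cong₂ _∧ₜ_ (subst-fixed x (λ w∈ → w∉ (x∈p∪q⁺ (inj₁ w∈))))
               (subst-fixed y (λ w∈ → w∉ (x∈p∪q⁺ (inj₂ w∈))))
  subst-fixed (x ∨ₜ y) w∉ =
    cong₂ _∨ₜ_ (subst-fixed x (λ w∈ → w∉ (x∈p∪q⁺ (inj₁ w∈))))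
               (subst-fixed y (λ w∈ → w∉ (x∈p∪q⁺ (inj₂ w∈))))

  reduct-fixed : ∀ {w t} → ConstantFree t → w ∉ ants t → reduct w t ≡ t
  reduct-fixed x w∉ rewrite subst-fixed x w∉ = simp-constantFree x

  reduct-simplified : ∀ w (t : Term n) → Simplified (reduct w t)
  reduct-simplified w t = simp-simplified (subst w t)

  reduct-conj : ∀ w {r s} → Simplified r → Simplified s →
                reduct w (conj r s) ≡ conj (reduct w r) (reduct w s)
  reduct-conj w {s = s} 𝟎 _ rewrite conj-zeroˡ s = sym (conj-zeroˡ (reduct w s))
  reduct-conj w {s = s} 𝟏 _ rewrite conj-identityˡ s = sym (conj-identityˡ (reduct w s))
  reduct-conj w {r = r} (constantFree _) 𝟎 rewrite conj-zeroʳ r = sym (conj-zeroʳ (reduct w r))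
  reduct-conj w (constantFree _) 𝟏 = refl
  reduct-conj w (constantFree x) (constantFree y) rewrite conj-constantFree x y = refl

  reduct-disj : ∀ w {r s} → Simplified r → Simplified s →
                reduct w (disj r s) ≡ disj (reduct w r) (reduct w s)
  reduct-disj w {s = s} 𝟎 _ rewrite disj-identityˡ s = sym (disj-identityˡ (reduct w s))
  reduct-disj w {s = s} 𝟏 _ rewrite disj-zeroˡ s = sym (disj-zeroˡ (reduct w s))
  reduct-disj w {r = r} (constantFree _) 𝟎 rewrite disj-identityʳ r = sym (disj-identityʳ (reduct w r))
  reduct-disj w (constantFree _) 𝟏 = refl
  reduct-disj w (constantFree x) (constantFree y) rewrite disj-constantFree x y = refl

  observe : Fin n → Valuation → Valuation
  observe w ν a b = if w ⊨ b then w ⊨ a else ν a b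

  ⟦subst⟧ : ∀ w (t : Term n) ν → ⟦ subst w t ⟧ ν ≡ ⟦ t ⟧ (observe w ν)
  ⟦subst⟧ w (cnd a b _) ν rewrite ⊨-∩ w a b with w ⊨ a | w ⊨ b
  ... | true  | true  = refl
  ... | true  | false = refl
  ... | false | true  = refl
  ... | false | false = refl
  ⟦subst⟧ w 𝟎 ν = refl
  ⟦subst⟧ w 𝟏 ν = refl
  ⟦subst⟧ w (¬ₜ t) ν = cong not (⟦subst⟧ w t ν)
  ⟦subst⟧ w (t ∧ₜ s) ν = cong₂ _∧_ (⟦subst⟧ w t ν) (⟦subst⟧ w s ν)
  ⟦subst⟧ w (t ∨ₜ s) ν = cong₂ _∨_ (⟦subst⟧ w t ν) (⟦subst⟧ w s ν)

  ≋-reduct : ∀ (t s : Term n) → t ≋ s → ∀ w → reduct w t ≋ reduct w s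
  ≋-reduct t s t≋s w ν = begin
    ⟦ simp (subst w t) ⟧ ν  ≡⟨ ⟦simp⟧ (subst w t) ν ⟩
    ⟦ subst w t ⟧ ν         ≡⟨ ⟦subst⟧ w t ν ⟩
    ⟦ t ⟧ (observe w ν)     ≡⟨ t≋s (observe w ν) ⟩
    ⟦ s ⟧ (observe w ν)     ≡⟨ ⟦subst⟧ w s ν ⟨
    ⟦ subst w s ⟧ ν         ≡⟨ ⟦simp⟧ (subst w s) ν ⟨
    ⟦ simp (subst w s) ⟧ ν  ∎
    where open ≡-Reasoning

  reduct-cnd-absorb : ∀ {a b c} {w : Fin n} {pb : Nonempty b} {pbc : Nonempty (b ∪ c)} →
                      a ⊆ b → w ∈ b ∪ c →
                      reduct w (cnd a b pb ∧ₜ cnd a (b ∪ c) pbc) ≡ reduct w (cnd a (b ∪ c) pbc)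
  reduct-cnd-absorb {a} {b} {c} {w} a⊆b w∈b∪c
    rewrite ⊨-∩ w a b | ⊨-∩ w a (b ∪ c) | ⊨-∪ w b c
    with w ⊨ a in ea | w ⊨ b in eb | w ⊨ c in ec
  ... | true  | true  | _     = refl
  ... | true  | false | _     = contradiction (a⊆b (⊨⇒∈ ea)) (⊭⇒∉ eb)
  ... | false | true  | _     = refl
  ... | false | false | true  = refl
  ... | false | false | false with x∈p∪q⁻ b c w∈b∪c
  ...   | inj₁ w∈b = contradiction w∈b (⊭⇒∉ eb)
  ...   | inj₂ w∈c = contradiction w∈c (⊭⇒∉ ec)

module Conditional {c ℓ₁ ℓ₂} (R : OrderedCommRing c ℓ₁ ℓ₂) {n : ℕ}
  (P : Subset n → Subset n → OrderedCommRing.Carrier R) (cp : IsCondProb R n P) where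

  open OrderedCommRing R
    hiding (_≤_; zero) renaming (refl to ≈-refl; sym to ≈-sym; trans to ≈-trans)
  open IsCondProb cp
  open RingProperties ring using (-1*x≈-x; x+x≈x⇒x≈0; -0#≈0#)
  open GroupProperties +-group
    using (//-rightDividesˡ; //-rightDividesʳ) renaming (x≈y⇒x∙y⁻¹≈ε to x≈y⇒x-y≈0)
  open SemiringSum semiring using (sum; sum-cong-≋; ∑-distrib-+; *-distribˡ-sum)
  open SetoidReasoning setoid

  sumFin≡sum : ∀ {m} (f : Fin m → Carrier) → sumFin R m f ≡ sum f
  sumFin≡sum {zero}  f = refl
  sumFin≡sum {suc m} f = cong (f zero +_) (sumFin≡sum (f ∘ suc))

  P-∅ : ∀ {d} → Nonempty d → P ∅ d ≈ 0#
  P-∅ {d} ne = x+x≈x⇒x≈0 (P ∅ d) (begin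
    P ∅ d + P ∅ d  ≈⟨ additive ∅ ∅ d ne (∩-zeroʳ ∅) ⟨
    P (∅ ∪ ∅) d    ≡⟨ cong (λ a → P a d) (∪-identityʳ ∅) ⟩
    P ∅ d          ∎)

  P-⋃ᶠ : ∀ {d} → Nonempty d → ∀ {m} (h : Fin m → Subset n) → Disjointᶠ h →
         sum (λ i → P (h i) d) ≈ P (⋃ᶠ h) d
  P-⋃ᶠ ne {zero}  h _ = ≈-sym (P-∅ ne)
  P-⋃ᶠ {d} ne {suc m} h disjoint = begin
    P (h zero) d + sum (λ i → P (h (suc i)) d)
      ≈⟨ +-congˡ (P-⋃ᶠ ne (h ∘ suc) (λ x∈ y∈ → suc-injective (disjoint x∈ y∈))) ⟩
    P (h zero) d + P (⋃ᶠ (h ∘ suc)) d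
      ≈⟨ additive (h zero) (⋃ᶠ (h ∘ suc)) d ne (Empty-unique separated) ⟨
    P (⋃ᶠ h) d
      ∎
    where
    separated : Empty (h zero ∩ ⋃ᶠ (h ∘ suc))
    separated (x , x∈)
      with x∈h₀ , x∈⋃ ← x∈p∩q⁻ (h zero) (⋃ᶠ (h ∘ suc)) x∈
      with i , x∈hᵢ ← x∈⋃ᶠ⁻ m x∈⋃
      with () ← disjoint x∈h₀ x∈hᵢ

  mass : Subset n → Subset n → Fin n → Carrier
  mass c d w = if w ⊨ c then P ⁅ w ⁆ d else 0#

  sum-mass : ∀ c {d} → Nonempty d → sum (mass c d) ≈ P c d
  sum-mass c {d} ne = begin
    sum (mass c d)              ≈⟨ sum-cong-≋ mass≈P∘atom ⟩
    sum (λ w → P (atom c w) d)  ≈⟨ P-⋃ᶠ ne (atom c) (atom-disjoint c) ⟩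
    P (⋃ᶠ (atom c)) d           ≡⟨ cong (λ a → P a d) (⋃ᶠ-atom c) ⟩
    P c d                       ∎
    where
    mass≈P∘atom : ∀ w → mass c d w ≈ P (atom c w) d
    mass≈P∘atom w with w ⊨ c
    ... | true  = ≈-refl
    ... | false = ≈-sym (P-∅ ne)

  P-atom-chain : ∀ {b c w} → b ⊆ c → w ∈ b → P ⁅ w ⁆ c ≈ P ⁅ w ⁆ b * P b c
  P-atom-chain {b} {c} {w} b⊆c w∈b = begin
    P ⁅ w ⁆ c              ≡⟨ cong (λ a → P a c) (p⊆q⇒p∩q≡p ⁅w⁆⊆b) ⟨
    P (⁅ w ⁆ ∩ b) c        ≈⟨ chain ⁅ w ⁆ b c (w , x∈p∩q⁺ (w∈b , b⊆c w∈b)) ⟩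
    P ⁅ w ⁆ (b ∩ c) * P b c ≡⟨ cong (λ d → P ⁅ w ⁆ d * P b c) (p⊆q⇒p∩q≡p b⊆c) ⟩
    P ⁅ w ⁆ b * P b c      ∎
    where
    ⁅w⁆⊆b : ⁅ w ⁆ ⊆ b
    ⁅w⁆⊆b x∈ with refl ← x∈⁅y⁆⇒x≡y w x∈ = w∈b

  -- ℙ(f ∣ c), written exactly as the summand of E.
  𝔼[_∣_] : (Fin n → Carrier) → Subset n → Carrier
  𝔼[ f ∣ c ] = sumFin R n (λ w → if w ⊨ c then f w * P ⁅ w ⁆ c else 0#)

  𝔼-weighted : ∀ c f → 𝔼[ f ∣ c ] ≈ sum (λ w → f w * mass c c w)
  𝔼-weighted c f = begin
    𝔼[ f ∣ c ]                                            ≡⟨ sumFin≡sum integrand ⟩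
    sum integrand                                         ≈⟨ sum-cong-≋ pointwise ⟩
    sum (λ w → f w * mass c c w)                          ∎
    where
    integrand : Fin n → Carrier
    integrand w = if w ⊨ c then f w * P ⁅ w ⁆ c else 0#
    pointwise : ∀ w → integrand w ≈ f w * mass c c w
    pointwise w with w ⊨ c
    ... | true  = ≈-refl
    ... | false = ≈-sym (zeroʳ (f w))

  𝔼-cong : ∀ c {f g} → (∀ {w} → w ∈ c → f w ≈ g w) → 𝔼[ f ∣ c ] ≈ 𝔼[ g ∣ c ]
  𝔼-cong c {f} {g} f≈g = begin
    𝔼[ f ∣ c ]                    ≈⟨ 𝔼-weighted c f ⟩
    sum (λ w → f w * mass c c w)  ≈⟨ sum-cong-≋ pointwise ⟩
    sum (λ w → g w * mass c c w)  ≈⟨ 𝔼-weighted c g ⟨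
    𝔼[ g ∣ c ]                    ∎
    where
    pointwise : ∀ w → f w * mass c c w ≈ g w * mass c c w
    pointwise w with w ⊨ c in e
    ... | true  = *-congʳ (f≈g (⊨⇒∈ e))
    ... | false = ≈-trans (zeroʳ (f w)) (≈-sym (zeroʳ (g w)))

  𝔼-+ : ∀ c f g → 𝔼[ (λ w → f w + g w) ∣ c ] ≈ 𝔼[ f ∣ c ] + 𝔼[ g ∣ c ]
  𝔼-+ c f g = begin
    𝔼[ (λ w → f w + g w) ∣ c ]
      ≈⟨ 𝔼-weighted c _ ⟩
    sum (λ w → (f w + g w) * mass c c w)
      ≈⟨ sum-cong-≋ (λ w → distribʳ (mass c c w) (f w) (g w)) ⟩
    sum (λ w → f w * mass c c w + g w * mass c c w)
      ≈⟨ ∑-distrib-+ (λ w → f w * mass c c w) (λ w → g w * mass c c w) ⟩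
    sum (λ w → f w * mass c c w) + sum (λ w → g w * mass c c w)
      ≈⟨ +-cong (𝔼-weighted c f) (𝔼-weighted c g) ⟨
    𝔼[ f ∣ c ] + 𝔼[ g ∣ c ]
      ∎

  𝔼-*ˡ : ∀ c k f → 𝔼[ (λ w → k * f w) ∣ c ] ≈ k * 𝔼[ f ∣ c ]
  𝔼-*ˡ c k f = begin
    𝔼[ (λ w → k * f w) ∣ c ]             ≈⟨ 𝔼-weighted c _ ⟩
    sum (λ w → (k * f w) * mass c c w)   ≈⟨ sum-cong-≋ (λ w → *-assoc k (f w) (mass c c w)) ⟩
    sum (λ w → k * (f w * mass c c w))   ≈⟨ *-distribˡ-sum k (λ w → f w * mass c c w) ⟨
    k * sum (λ w → f w * mass c c w)     ≈⟨ *-congˡ (𝔼-weighted c f) ⟨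
    k * 𝔼[ f ∣ c ]                       ∎

  𝔼-- : ∀ c f g → 𝔼[ (λ w → f w - g w) ∣ c ] ≈ 𝔼[ f ∣ c ] - 𝔼[ g ∣ c ]
  𝔼-- c f g = begin
    𝔼[ (λ w → f w - g w) ∣ c ]            ≈⟨ 𝔼-cong c (λ {w} _ → +-congˡ (-1*x≈-x (g w))) ⟨
    𝔼[ (λ w → f w + - 1# * g w) ∣ c ]     ≈⟨ 𝔼-+ c f _ ⟩
    𝔼[ f ∣ c ] + 𝔼[ (λ w → - 1# * g w) ∣ c ] ≈⟨ +-congˡ (𝔼-*ˡ c (- 1#) g) ⟩
    𝔼[ f ∣ c ] + - 1# * 𝔼[ g ∣ c ]        ≈⟨ +-congˡ (-1*x≈-x _) ⟩
    𝔼[ f ∣ c ] - 𝔼[ g ∣ c ]               ∎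

  𝔼-const : ∀ {c} → Nonempty c → ∀ k → 𝔼[ (λ _ → k) ∣ c ] ≈ k
  𝔼-const {c} ne k = begin
    𝔼[ (λ _ → k) ∣ c ]          ≈⟨ 𝔼-weighted c _ ⟩
    sum (λ w → k * mass c c w)  ≈⟨ *-distribˡ-sum k (mass c c) ⟨
    k * sum (mass c c)          ≈⟨ *-congˡ (≈-trans (sum-mass c ne) (self c ne)) ⟩
    k * 1#                      ≈⟨ *-identityʳ k ⟩
    k                           ∎

  𝔼-restrict : ∀ {b c} g → b ⊆ c → (∀ {w} → w ∉ b → g w ≈ 0#) →
               𝔼[ g ∣ c ] ≈ P b c * 𝔼[ g ∣ b ]
  𝔼-restrict {b} {c} g b⊆c g≈0 = begin
    𝔼[ g ∣ c ]                               ≈⟨ 𝔼-weighted c g ⟩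
    sum (λ w → g w * mass c c w)             ≈⟨ sum-cong-≋ pointwise ⟩
    sum (λ w → P b c * (g w * mass b b w))   ≈⟨ *-distribˡ-sum (P b c) (λ w → g w * mass b b w) ⟨
    P b c * sum (λ w → g w * mass b b w)     ≈⟨ *-congˡ (𝔼-weighted b g) ⟨
    P b c * 𝔼[ g ∣ b ]                       ∎
    where
    pointwise : ∀ w → g w * mass c c w ≈ P b c * (g w * mass b b w)
    pointwise w with w ⊨ b in eb | w ⊨ c in ec
    ... | true  | true  = begin
      g w * P ⁅ w ⁆ c             ≈⟨ *-congˡ (P-atom-chain b⊆c (⊨⇒∈ eb)) ⟩
      g w * (P ⁅ w ⁆ b * P b c)   ≈⟨ *-assoc (g w) _ _ ⟨
      (g w * P ⁅ w ⁆ b) * P b c   ≈⟨ *-comm _ (P b c) ⟩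
      P b c * (g w * P ⁅ w ⁆ b)   ∎
    ... | true  | false = contradiction (b⊆c (⊨⇒∈ eb)) (⊭⇒∉ ec)
    ... | false | true  = begin
      g w * P ⁅ w ⁆ c     ≈⟨ *-congʳ (g≈0 (⊭⇒∉ eb)) ⟩
      0# * P ⁅ w ⁆ c      ≈⟨ zeroˡ _ ⟩
      0#                  ≈⟨ zeroʳ (P b c) ⟨
      P b c * 0#          ≈⟨ *-congˡ (zeroʳ (g w)) ⟨
      P b c * (g w * 0#)  ∎
    ... | false | false = begin
      g w * 0#            ≈⟨ zeroʳ (g w) ⟩
      0#                  ≈⟨ zeroʳ (P b c) ⟨
      P b c * 0#          ≈⟨ *-congˡ (zeroʳ (g w)) ⟨
      P b c * (g w * 0#)  ∎

  -- f - 𝔼[ f ∣ b ] vanishes off b, so over c its expectation is P b c times the one over b,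
  -- which is 0.
  𝔼-tower : ∀ {b c} f → b ⊆ c → Nonempty b → (∀ {w} → w ∉ b → f w ≈ 𝔼[ f ∣ b ]) →
            𝔼[ f ∣ c ] ≈ 𝔼[ f ∣ b ]
  𝔼-tower {b} {c} f b⊆c ne f≈K = begin
    𝔼[ f ∣ c ]
      ≈⟨ 𝔼-cong c (λ {w} _ → //-rightDividesˡ K (f w)) ⟨
    𝔼[ (λ w → (f w - K) + K) ∣ c ]
      ≈⟨ 𝔼-+ c _ _ ⟩
    𝔼[ (λ w → f w - K) ∣ c ] + 𝔼[ (λ _ → K) ∣ c ]
      ≈⟨ +-cong (𝔼-restrict _ b⊆c (λ w∉b → x≈y⇒x-y≈0 (f≈K w∉b))) (𝔼-const ne-c K) ⟩
    P b c * 𝔼[ (λ w → f w - K) ∣ b ] + K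
      ≈⟨ +-congʳ (*-congˡ (𝔼-- b f _)) ⟩
    P b c * (K - 𝔼[ (λ _ → K) ∣ b ]) + K
      ≈⟨ +-congʳ (*-congˡ (x≈y⇒x-y≈0 (≈-sym (𝔼-const ne K)))) ⟩
    P b c * 0# + K
      ≈⟨ +-congʳ (zeroʳ (P b c)) ⟩
    0# + K
      ≈⟨ +-identityˡ K ⟩
    K
      ∎
    where
    K = 𝔼[ f ∣ b ]
    ne-c : Nonempty c
    ne-c = proj₁ ne , b⊆c (proj₂ ne)

  E-unfold : ∀ k {u} → ConstantFree u →
             E R n P (suc k) u ≡ 𝔼[ (λ w → E R n P k (reduct w u)) ∣ ants u ]
  E-unfold k cnd      = refl
  E-unfold k (¬ₜ _)   = refl
  E-unfold k (_ ∧ₜ _) = refl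
  E-unfold k (_ ∨ₜ _) = refl

  E-fuel : ∀ {u} → Simplified u → ∀ {k k′} → occ u < k → occ u < k′ →
           E R n P k u ≈ E R n P k′ u
  E-fuel 𝟎 {suc _} {suc _} _ _ = ≈-refl
  E-fuel 𝟏 {suc _} {suc _} _ _ = ≈-refl
  E-fuel {u} (constantFree x) {suc k} {suc k′} (s≤s h) (s≤s h′) = begin
    E R n P (suc k) u                                 ≡⟨ E-unfold k x ⟩
    𝔼[ (λ w → E R n P k (reduct w u)) ∣ ants u ]      ≈⟨ 𝔼-cong (ants u) fuel-irrelevant ⟩
    𝔼[ (λ w → E R n P k′ (reduct w u)) ∣ ants u ]     ≡⟨ E-unfold k′ x ⟨
    E R n P (suc k′) u                                ∎
    where
    fuel-irrelevant : ∀ {w} → w ∈ ants u → E R n P k (reduct w u) ≈ E R n P k′ (reduct w u)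
    fuel-irrelevant {w} w∈ =
      E-fuel (reduct-simplified w u)
             (<-≤-trans (occ-reduct-< u w∈) h) (<-≤-trans (occ-reduct-< u w∈) h′)

  -- ℙ(X_u ∣ 𝐛(u)); meaningful only for simplified u (𝐛 (𝟏 ∧ₜ 𝟏) is empty, for instance).
  value : Term n → Carrier
  value u = E R n P (suc (occ u)) u

  E≈value : ∀ {u k} → Simplified u → occ u < k → E R n P k u ≈ value u
  E≈value su h = E-fuel su h (n<1+n _)

  value-unfold : ∀ {u} → ConstantFree u → value u ≈ 𝔼[ (λ w → value (reduct w u)) ∣ ants u ]
  value-unfold {u} x = begin
    value u
      ≡⟨ E-unfold (occ u) x ⟩
    𝔼[ (λ w → E R n P (occ u) (reduct w u)) ∣ ants u ]
      ≈⟨ 𝔼-cong (ants u) (λ {w} w∈ → E≈value (reduct-simplified w u) (occ-reduct-< u w∈)) ⟩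
    𝔼[ (λ w → value (reduct w u)) ∣ ants u ]
      ∎

  value-tower : ∀ {u C} → Simplified u → ants u ⊆ C → Nonempty C →
                value u ≈ 𝔼[ (λ w → value (reduct w u)) ∣ C ]
  value-tower 𝟎 _ ne = ≈-sym (𝔼-const ne 0#)
  value-tower 𝟏 _ ne = ≈-sym (𝔼-const ne 1#)
  value-tower {u} {C} (constantFree x) ants⊆C _ = begin
    value u                                   ≈⟨ value-unfold x ⟩
    𝔼[ (λ w → value (reduct w u)) ∣ ants u ]  ≈⟨ 𝔼-tower _ ants⊆C (nonempty-ants x) outside ⟨
    𝔼[ (λ w → value (reduct w u)) ∣ C ]       ∎
    where
    outside : ∀ {w} → w ∉ ants u → value (reduct w u) ≈ 𝔼[ (λ w → value (reduct w u)) ∣ ants u ]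
    outside w∉ = ≈-trans (reflexive (cong value (reduct-fixed x w∉))) (value-unfold x)

  value-cong-reducts : ∀ {L M C} → Simplified L → Simplified M →
                       ants L ⊆ C → ants M ⊆ C → Nonempty C →
                       (∀ {w} → w ∈ C → value (reduct w L) ≈ value (reduct w M)) →
                       value L ≈ value M
  value-cong-reducts {L} {M} {C} sL sM L⊆C M⊆C ne same = begin
    value L                               ≈⟨ value-tower sL L⊆C ne ⟩
    𝔼[ (λ w → value (reduct w L)) ∣ C ]   ≈⟨ 𝔼-cong C same ⟩
    𝔼[ (λ w → value (reduct w M)) ∣ C ]   ≈⟨ value-tower sM M⊆C ne ⟨
    value M                               ∎

  value-≋-step : ∀ N {L M} → Simplified L → Simplified M → L ≋ M → occ L +ℕ occ M ≤ N →
                 Nonempty (ants L ∪ ants M) → value L ≈ value M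

  value-≋-bounded : ∀ N {L M} → Simplified L → Simplified M → L ≋ M → occ L +ℕ occ M < N →
                    value L ≈ value M
  value-≋-bounded _ 𝟎 𝟎 _ _ = ≈-refl
  value-≋-bounded _ 𝟏 𝟏 _ _ = ≈-refl
  value-≋-bounded _ 𝟎 𝟏 L≋M _ with () ← L≋M (λ _ _ → true)
  value-≋-bounded _ 𝟏 𝟎 L≋M _ with () ← L≋M (λ _ _ → true)
  value-≋-bounded (suc N) sL@(constantFree x) sM L≋M (s≤s h)
    with w , w∈ ← nonempty-ants x =
    value-≋-step N sL sM L≋M h (w , x∈p∪q⁺ (inj₁ w∈))
  value-≋-bounded (suc N) sL sM@(constantFree y) L≋M (s≤s h)
    with w , w∈ ← nonempty-ants y =
    value-≋-step N sL sM L≋M h (w , x∈p∪q⁺ (inj₂ w∈))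

  value-≋-step N {L} {M} sL sM L≋M h ne =
    value-cong-reducts sL sM (p⊆p∪q (ants M)) (q⊆p∪q (ants L) (ants M)) ne λ {w} w∈ →
      value-≋-bounded N (reduct-simplified w L) (reduct-simplified w M) (≋-reduct L M L≋M w)
        (<-≤-trans (occ-reduct₂-< L M w∈) h)

  value-≋ : ∀ {L M} → Simplified L → Simplified M → L ≋ M → value L ≈ value M
  value-≋ sL sM L≋M = value-≋-bounded _ sL sM L≋M (n<1+n _)

  value-disj-step : ∀ N {u v} → Simplified u → Simplified v → occ u +ℕ occ v ≤ N →
                    Nonempty (ants u ∪ ants v) →
                    value (disj u v) ≈ (value u + value v) - value (conj u v)

  value-disj-bounded : ∀ N {u v} → Simplified u → Simplified v → occ u +ℕ occ v < N →
                       value (disj u v) ≈ (value u + value v) - value (conj u v)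
  value-disj-bounded _ 𝟎 𝟎 _ = ≈-sym (//-rightDividesʳ 0# 0#)
  value-disj-bounded _ 𝟎 𝟏 _ = ≈-sym (≈-trans (+-congʳ (+-comm 0# 1#)) (//-rightDividesʳ 0# 1#))
  value-disj-bounded _ 𝟏 𝟎 _ = ≈-sym (//-rightDividesʳ 0# 1#)
  value-disj-bounded _ 𝟏 𝟏 _ = ≈-sym (//-rightDividesʳ 1# 1#)
  value-disj-bounded (suc N) su@(constantFree x) sv (s≤s h)
    with w , w∈ ← nonempty-ants x =
    value-disj-step N su sv h (w , x∈p∪q⁺ (inj₁ w∈))
  value-disj-bounded (suc N) su sv@(constantFree y) (s≤s h)
    with w , w∈ ← nonempty-ants y =
    value-disj-step N su sv h (w , x∈p∪q⁺ (inj₂ w∈))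

  value-disj-step N {u} {v} su sv h ne = begin
    value (disj u v)
      ≈⟨ value-tower (simplified-disj su sv) (ants-disj su sv) ne ⟩
    𝔼[ (λ w → value (reduct w (disj u v))) ∣ C ]
      ≈⟨ 𝔼-cong C induction-step ⟩
    𝔼[ (λ w → (value (reduct w u) + value (reduct w v)) - value (conj (reduct w u) (reduct w v))) ∣ C ]
      ≈⟨ 𝔼-- C _ _ ⟩
    𝔼[ (λ w → value (reduct w u) + value (reduct w v)) ∣ C ]
      - 𝔼[ (λ w → value (conj (reduct w u) (reduct w v))) ∣ C ]
      ≈⟨ +-congʳ (𝔼-+ C _ _) ⟩
    (𝔼[ (λ w → value (reduct w u)) ∣ C ] + 𝔼[ (λ w → value (reduct w v)) ∣ C ])
      - 𝔼[ (λ w → value (conj (reduct w u) (reduct w v))) ∣ C ]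
      ≈⟨ +-cong (+-cong (value-tower su (p⊆p∪q (ants v)) ne)
                        (value-tower sv (q⊆p∪q (ants u) (ants v)) ne))
                (-‿cong conj-tower) ⟨
    (value u + value v) - value (conj u v)
      ∎
    where
    C = ants u ∪ ants v
    induction-step : ∀ {w} → w ∈ C → value (reduct w (disj u v)) ≈
                     (value (reduct w u) + value (reduct w v)) - value (conj (reduct w u) (reduct w v))
    induction-step {w} w∈ =
      ≈-trans (reflexive (cong value (reduct-disj w su sv)))
              (value-disj-bounded N (reduct-simplified w u) (reduct-simplified w v)
                                    (<-≤-trans (occ-reduct₂-< u v w∈) h))
    conj-tower : value (conj u v) ≈ 𝔼[ (λ w → value (conj (reduct w u) (reduct w v))) ∣ C ]
    conj-tower = ≈-trans (value-tower (simplified-conj su sv) (ants-conj su sv) ne)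
                       (𝔼-cong C (λ {w} _ → reflexive (cong value (reduct-conj w su sv))))

  value-disj : ∀ {u v} → Simplified u → Simplified v →
               value (disj u v) ≈ (value u + value v) - value (conj u v)
  value-disj su sv = value-disj-bounded _ su sv (n<1+n _)

  X≈value : ∀ t w → X R n P t w ≈ value (reduct w t)
  X≈value t w = E≈value (reduct-simplified w t) (s≤s (occ-reduct w t))

  X-≋ : ∀ t s → t ≋ s → _≐_ R n P (X R n P t) (X R n P s)
  X-≋ t s t≋s w = begin
    X R n P t w
      ≈⟨ X≈value t w ⟩
    value (reduct w t)
      ≈⟨ value-≋ (reduct-simplified w t) (reduct-simplified w s) (≋-reduct t s t≋s w) ⟩
    value (reduct w s)
      ≈⟨ X≈value s w ⟨
    X R n P s w
      ∎

  X-∨ : ∀ t s w → X R n P (t ∨ₜ s) w ≈ (X R n P t w + X R n P s w) - X R n P (t ∧ₜ s) w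
  X-∨ t s w = begin
    X R n P (t ∨ₜ s) w
      ≈⟨ X≈value (t ∨ₜ s) w ⟩
    value (disj (reduct w t) (reduct w s))
      ≈⟨ value-disj (reduct-simplified w t) (reduct-simplified w s) ⟩
    (value (reduct w t) + value (reduct w s)) - value (conj (reduct w t) (reduct w s))
      ≈⟨ +-cong (+-cong (X≈value t w) (X≈value s w)) (-‿cong (X≈value (t ∧ₜ s) w)) ⟨
    (X R n P t w + X R n P s w) - X R n P (t ∧ₜ s) w
      ∎

  X-¬ : ∀ t w → X R n P (¬ₜ t) w ≈ 1# - X R n P t w
  X-¬ t w = begin
    b            ≈⟨ //-rightDividesʳ a b ⟨
    (b + a) - a  ≈⟨ +-congʳ (≈-trans (+-comm b a) a+b≈1) ⟩
    1# - a       ∎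
    where
    a = X R n P t w
    b = X R n P (¬ₜ t) w
    a+b≈1 : a + b ≈ 1#
    a+b≈1 = begin
      a + b
        ≈⟨ +-identityʳ (a + b) ⟨
      (a + b) + 0#
        ≈⟨ +-congˡ -0#≈0# ⟨
      (a + b) - 0#
        ≈⟨ +-congˡ (-‿cong (X-≋ (t ∧ₜ ¬ₜ t) 𝟎 (λ ν → ∧-inverseʳ (⟦ t ⟧ ν)) w)) ⟨
      (a + b) - X R n P (t ∧ₜ ¬ₜ t) w
        ≈⟨ X-∨ t (¬ₜ t) w ⟨
      X R n P (t ∨ₜ ¬ₜ t) w
        ≈⟨ X-≋ (t ∨ₜ ¬ₜ t) 𝟏 (λ ν → ∨-inverseʳ (⟦ t ⟧ ν)) w ⟩
      1#
        ∎

  X-cnd-absorb : ∀ {a b c} (pb : Nonempty b) (pbc : Nonempty (b ∪ c)) → a ⊆ b →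
                 _≐_ R n P (X R n P (cnd a b pb ∧ₜ cnd a (b ∪ c) pbc))
                           (X R n P (cnd a (b ∪ c) pbc))
  X-cnd-absorb {a} {b} {c} pb pbc a⊆b w = begin
    X R n P L w         ≈⟨ X≈value L w ⟩
    value (reduct w L)  ≈⟨ reducts-agree ⟩
    value (reduct w M)  ≈⟨ X≈value M w ⟨
    X R n P M w         ∎
    where
    L = cnd a b pb ∧ₜ cnd a (b ∪ c) pbc
    M = cnd a (b ∪ c) pbc
    antsL⊆b∪c : ants L ⊆ b ∪ c
    antsL⊆b∪c x∈ with x∈p∪q⁻ b (b ∪ c) x∈
    ... | inj₁ x∈b   = x∈p∪q⁺ (inj₁ x∈b)
    ... | inj₂ x∈b∪c = x∈b∪c
    same-on-b∪c : ∀ {v} → v ∈ b ∪ c → value (reduct v L) ≈ value (reduct v M)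
    same-on-b∪c v∈ = reflexive (cong value (reduct-cnd-absorb {a = a} {pb = pb} {pbc = pbc} a⊆b v∈))
    reducts-agree : value (reduct w L) ≈ value (reduct w M)
    reducts-agree with w ∈? b ∪ c
    ... | yes w∈ = same-on-b∪c w∈
    ... | no w∉  = begin
      value (reduct w L)
        ≡⟨ cong value (reduct-fixed {t = L} (cnd ∧ₜ cnd) (λ w∈ → w∉ (antsL⊆b∪c w∈))) ⟩
      value L
        ≈⟨ value-cong-reducts {L} {M} (constantFree (cnd ∧ₜ cnd)) (constantFree cnd)
                              antsL⊆b∪c ⊆-refl pbc same-on-b∪c ⟩
      value M
        ≡⟨ cong value (reduct-fixed {t = M} cnd w∉) ⟨
      value (reduct w M)
        ∎

proposition4p4 : ∀ {c ℓ₁ ℓ₂} (R : OrderedCommRing c ℓ₁ ℓ₂) (n : ℕ)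
    (P : Subset n → Subset n → OrderedCommRing.Carrier R) →
    IsCondProb R n P →
    let open OrderedCommRing R
        X' = X R n P
        _≐'_ = _≐_ R n P
    in (∀ t → X' t ≐' X' (t ∧ₜ t))
     × (∀ t s → X' (t ∧ₜ s) ≐' X' (s ∧ₜ t))
     × (∀ t s r → X' (t ∧ₜ (s ∧ₜ r)) ≐' X' ((t ∧ₜ s) ∧ₜ r))
     × (∀ t → X' (t ∧ₜ ¬ₜ t) ≐' (λ _ → 0#))
     × (∀ t s → X' (¬ₜ (t ∧ₜ s)) ≐' X' (¬ₜ t ∨ₜ ¬ₜ s))
     × (∀ t s r → X' (t ∧ₜ (s ∨ₜ r)) ≐' X' ((t ∧ₜ s) ∨ₜ (t ∧ₜ r)))
     × (∀ t s → X' (t ∨ₜ s) ≐' (λ w → (X' t w + X' s w) - X' (t ∧ₜ s) w))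
     × (∀ t → X' (¬ₜ t) ≐' (λ w → 1# - X' t w))
     × (∀ t → X' (¬ₜ ¬ₜ t) ≐' X' t)
     × (∀ a b c (pb : Nonempty b) (pbc : Nonempty (b ∪ c)) → a ⊆ b →
          X' (cnd a b pb ∧ₜ cnd a (b ∪ c) pbc) ≐' X' (cnd a (b ∪ c) pbc))
proposition4p4 R n P cp =
    (λ t → X-≋ t (t ∧ₜ t) (λ ν → sym (∧-idem (⟦ t ⟧ ν))))
  , (λ t s → X-≋ (t ∧ₜ s) (s ∧ₜ t) (λ ν → ∧-comm (⟦ t ⟧ ν) (⟦ s ⟧ ν)))
  , (λ t s r → X-≋ (t ∧ₜ (s ∧ₜ r)) ((t ∧ₜ s) ∧ₜ r)
                   (λ ν → sym (∧-assoc (⟦ t ⟧ ν) (⟦ s ⟧ ν) (⟦ r ⟧ ν))))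
  , (λ t → X-≋ (t ∧ₜ ¬ₜ t) 𝟎 (λ ν → ∧-inverseʳ (⟦ t ⟧ ν)))
  , (λ t s → X-≋ (¬ₜ (t ∧ₜ s)) (¬ₜ t ∨ₜ ¬ₜ s)
                 (λ ν → deMorgan₁ (⟦ t ⟧ ν) (⟦ s ⟧ ν)))
  , (λ t s r → X-≋ (t ∧ₜ (s ∨ₜ r)) ((t ∧ₜ s) ∨ₜ (t ∧ₜ r))
                   (λ ν → ∧-distribˡ-∨ (⟦ t ⟧ ν) (⟦ s ⟧ ν) (⟦ r ⟧ ν)))
  , X-∨
  , X-¬
  , (λ t → X-≋ (¬ₜ ¬ₜ t) t (λ ν → not-involutive (⟦ t ⟧ ν)))
  , (λ _ _ _ → X-cnd-absorb)
  where open Conditional R P cp
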